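{- Let $G=(V,E)$ be an undirected graph with positive edge weights and $T\subseteq V$ a terminal set. If $\mu(R)$ is defined for $R\subseteq T$, then $\mu(R)$ is an extreme set and $\mu(R)\cap T=R$.
   Context: For $X\subseteq V$, $d(X)$ is the total weight of edges with exactly one endpoint in $X$. A Steiner cut is a set $X\subseteq V$ with $X\cap T\neq\emptyset$ and $T\not\subseteq X$. A Steiner cut $X$ is extreme if every Steiner cut $Y\subsetneq X$ satisfies $d(Y)>d(X)$. For $R\subseteq T$, if there is at least one extreme set $X$ with $X\cap T=R$, the supreme set of $R$ is $\mu(R)=\bigcup\{X : X \text{ extreme},\ X\cap T=R\}$; otherwise $\mu(R)$ is undefined.
   Formalization: The edge weights are positive rationals. -}

module Defs where

open import Data.Nat using (ℕ)
open import Data.Bool using (Bool; true; false; if_then_else_; _xor_)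
open import Data.Fin using (Fin)
open import Data.Fin.Subset using (Subset; _∈_; _⊆_; _⊂_; _∩_; Nonempty)
open import Data.Vec using (lookup)
open import Data.Product using (Σ; _×_; _,_; ∃)
open import Data.List using (List; foldr)
open import Data.List.Relation.Unary.All using (All)
open import Data.Rational using (ℚ; 0ℚ; _+_; _<_)
open import Relation.Nullary using (¬_)
open import Relation.Binary.PropositionalEquality using (_≡_)
open import Function.Bundles using (_⇔_)

Edge : ℕ → Set
Edge n = Fin n × Fin n × ℚ

-- An undirected weighted (multi)graph on vertex set Fin n: a list of edges.
Graph : ℕ → Set
Graph n = List (Edge n)

PositiveWeights : ∀ {n} → Graph n → Set
PositiveWeights G = All (λ e → 0ℚ < Data.Product.proj₂ (Data.Product.proj₂ e)) G

crossWeight : ∀ {n} → Subset n → Edge n → ℚ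
crossWeight X (u , v , w) = if lookup X u xor lookup X v then w else 0ℚ

d : ∀ {n} → Graph n → Subset n → ℚ
d G X = foldr (λ e acc → crossWeight X e + acc) 0ℚ G

SteinerCut : ∀ {n} → Subset n → Subset n → Set
SteinerCut T X = Nonempty (X ∩ T) × ¬ (T ⊆ X)

Extreme : ∀ {n} → Graph n → Subset n → Subset n → Set
Extreme G T X =
  SteinerCut T X × (∀ Y → SteinerCut T Y → Y ⊂ X → d G X < d G Y)

-- μ(R) is defined: some extreme set X has X ∩ T = R.
SupremeDefined : ∀ {n} → Graph n → Subset n → Subset n → Set
SupremeDefined G T R = ∃ λ X → Extreme G T X × (X ∩ T ≡ R)

-- M is the supreme set μ(R): M is the union of all extreme X with X ∩ T = R.
IsSupremeSet : ∀ {n} → Graph n → Subset n → Subset n → Subset n → Set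
IsSupremeSet {n} G T R M =
  ∀ (x : Fin n) → (x ∈ M) ⇔ (∃ λ X → Extreme G T X × (X ∩ T ≡ R) × x ∈ X)

{-# OPTIONS --safe #-}
module Submission where

-- The cut function d is submodular. If X is extreme and W is a Steiner cut sharing a terminal
-- with X, then W ∩ X is a Steiner cut inside X, so d X ≤ d (W ∩ X) and submodularity gives
-- d (W ∪ X) ≤ d W, strictly unless X ⊆ W. Hence for extreme X, Y with the same terminals any
-- Steiner cut Z ⊊ X ∪ Y satisfies d (X ∪ Y) ≤ d (Z ∪ X) ≤ d Z with one inequality strict,
-- i.e. X ∪ Y is extreme; μ(R) is a finite union of such sets.

open import Defs
open import Algebra.Bundles using (AbelianGroup)
import Algebra.Properties.CommutativeSemigroup as CommutativeSemigroupProperties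
open import Data.Bool using (Bool; true; false; if_then_else_; _xor_; _∧_; _∨_)
open import Data.Fin using (Fin)
open import Data.Fin.Subset using (Subset; _∈_; _⊆_; _⊂_; _∩_; _∪_; Nonempty)
open import Data.Fin.Subset.Properties
  using (_∈?_; _⊂?_; ⊆-antisym; ⊂-irref; p⊆p∪q; q⊆p∪q; x∈p∪q⁻; p∩q⊆q;
         x∈p∩q⁺; x∈p∩q⁻; ∪-assoc; ∪-idem; ∪-abs-∩; ∩-distribʳ-∪)
open import Data.List using (List; []; _∷_; allFin)
import Data.List.Membership.Propositional as List
open import Data.List.Membership.Propositional.Properties using (∈-allFin)
open import Data.List.Relation.Unary.All as All using (All; []; _∷_)
open import Data.List.Relation.Unary.Any using (here; there)
open import Data.Nat using (ℕ)
open import Data.Vec using (lookup)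
open import Data.Vec.Properties using (lookup-zipWith)
open import Data.Empty using (⊥-elim)
open import Data.Product using (∃; _×_; _,_; proj₁; proj₂)
open import Data.Rational using (ℚ; 0ℚ; _+_; -_; _<_; _≤_)
open import Data.Rational.Properties
open import Data.Sum using (_⊎_; inj₁; inj₂; [_,_])
open import Function.Base using (id)
open import Function.Bundles using (Equivalence)
open import Relation.Nullary using (¬_; yes; no)
open import Relation.Nullary.Negation using (contradiction)
open import Relation.Binary.PropositionalEquality using (_≡_; refl; sym; trans; cong; subst; subst₂; module ≡-Reasoning)

+-cancelʳ-< : ∀ {p q} r → p + r < q + r → p < q
+-cancelʳ-< {p} {q} r p+r<q+r = subst₂ _<_ (+-cancel p) (+-cancel q) (+-monoˡ-< (- r) p+r<q+r)
  where
  open ≡-Reasoning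
  +-cancel : ∀ x → x + r + - r ≡ x
  +-cancel x = begin
    x + r + - r   ≡⟨ +-assoc x r (- r) ⟩
    x + (r + - r) ≡⟨ cong (x +_) (+-inverseʳ r) ⟩
    x + 0ℚ        ≡⟨ +-identityʳ x ⟩
    x             ∎

NonNegativeWeights : ∀ {n} → Graph n → Set
NonNegativeWeights G = All (λ e → 0ℚ ≤ proj₂ (proj₂ e)) G

xor-weight-submodular : ∀ (a b c e : Bool) {w} → 0ℚ ≤ w →
  (if (a ∧ c) xor (b ∧ e) then w else 0ℚ) + (if (a ∨ c) xor (b ∨ e) then w else 0ℚ)
  ≤ (if a xor b then w else 0ℚ) + (if c xor e then w else 0ℚ)
xor-weight-submodular true  true  true  true  _   = ≤-refl
xor-weight-submodular true  true  true  false {w} _ = ≤-reflexive (+-comm w 0ℚ)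
xor-weight-submodular true  true  false true  {w} _ = ≤-reflexive (+-comm w 0ℚ)
xor-weight-submodular true  true  false false _   = ≤-refl
xor-weight-submodular true  false true  true  _   = ≤-refl
xor-weight-submodular true  false true  false _   = ≤-refl
xor-weight-submodular true  false false true  0≤w = +-mono-≤ 0≤w 0≤w
xor-weight-submodular true  false false false {w} _ = ≤-reflexive (+-comm 0ℚ w)
xor-weight-submodular false true  true  true  _   = ≤-refl
xor-weight-submodular false true  true  false 0≤w = +-mono-≤ 0≤w 0≤w
xor-weight-submodular false true  false true  _   = ≤-refl
xor-weight-submodular false true  false false {w} _ = ≤-reflexive (+-comm 0ℚ w)
xor-weight-submodular false false true  true  _   = ≤-refl
xor-weight-submodular false false true  false _   = ≤-refl
xor-weight-submodular false false false true  _   = ≤-refl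
xor-weight-submodular false false false false _   = ≤-refl

crossWeight-submodular : ∀ {n} (A B : Subset n) (e : Edge n) → 0ℚ ≤ proj₂ (proj₂ e) →
  crossWeight (A ∩ B) e + crossWeight (A ∪ B) e ≤ crossWeight A e + crossWeight B e
crossWeight-submodular A B (u , v , w) 0≤w
  rewrite lookup-zipWith _∧_ u A B | lookup-zipWith _∧_ v A B
        | lookup-zipWith _∨_ u A B | lookup-zipWith _∨_ v A B
  = xor-weight-submodular (lookup A u) (lookup A v) (lookup B u) (lookup B v) 0≤w

d-submodular : ∀ {n} (G : Graph n) → NonNegativeWeights G → (A B : Subset n) →
  d G (A ∩ B) + d G (A ∪ B) ≤ d G A + d G B
d-submodular []      []            A B = ≤-refl
d-submodular (e ∷ G) (0≤w ∷ 0≤ws) A B = begin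
  (crossWeight (A ∩ B) e + d G (A ∩ B)) + (crossWeight (A ∪ B) e + d G (A ∪ B))
    ≡⟨ interchange (crossWeight (A ∩ B) e) (d G (A ∩ B)) (crossWeight (A ∪ B) e) (d G (A ∪ B)) ⟩
  (crossWeight (A ∩ B) e + crossWeight (A ∪ B) e) + (d G (A ∩ B) + d G (A ∪ B))
    ≤⟨ +-mono-≤ (crossWeight-submodular A B e 0≤w) (d-submodular G 0≤ws A B) ⟩
  (crossWeight A e + crossWeight B e) + (d G A + d G B)
    ≡⟨ interchange (crossWeight A e) (crossWeight B e) (d G A) (d G B) ⟩
  (crossWeight A e + d G A) + (crossWeight B e + d G B) ∎
  where
  open ≤-Reasoning
  open CommutativeSemigroupProperties (AbelianGroup.commutativeSemigroup +-0-abelianGroup)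
    using (interchange)

⊆⇒≡⊎⊂ : ∀ {n} {p q : Subset n} → p ⊆ q → p ≡ q ⊎ p ⊂ q
⊆⇒≡⊎⊂ {p = p} {q} p⊆q with p ⊂? q
... | yes p⊂q = inj₂ p⊂q
... | no  p⊄q = inj₁ (⊆-antisym p⊆q q⊆p)
  where
  q⊆p : q ⊆ p
  q⊆p {x} x∈q with x ∈? p
  ... | yes x∈p = x∈p
  ... | no  x∉p = contradiction ((λ {y} → p⊆q {y}) , x , x∈q , x∉p) p⊄q

⊆⇒∪≡ : ∀ {n} {p q : Subset n} → p ⊆ q → p ∪ q ≡ q
⊆⇒∪≡ {p = p} {q} p⊆q = ⊆-antisym (λ x∈p∪q → [ p⊆q , id ] (x∈p∪q⁻ p q x∈p∪q)) (q⊆p∪q p q)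

∩-trace-∈ : ∀ {n} {p q r : Subset n} {x} → p ∩ r ≡ q ∩ r → x ∈ p → x ∈ r → x ∈ q
∩-trace-∈ {q = q} {r} p∩r≡q∩r x∈p x∈r =
  proj₁ (x∈p∩q⁻ q r (subst (_ ∈_) p∩r≡q∩r (x∈p∩q⁺ (x∈p , x∈r))))

Descends : ∀ {n} → Graph n → Subset n → Subset n → Set
Descends G A B = B ≡ A ⊎ d G B < d G A

Descends-trans : ∀ {n} {G : Graph n} {A B C} → Descends G A B → Descends G B C → Descends G A C
Descends-trans (inj₁ refl)   B⇝C         = B⇝C
Descends-trans (inj₂ dB<dA) (inj₁ refl)  = inj₂ dB<dA
Descends-trans (inj₂ dB<dA) (inj₂ dC<dB) = inj₂ (<-trans dC<dB dB<dA)

module _ {n} {G : Graph n} {T : Subset n} where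

  extreme-descends : ∀ {X W} → Extreme G T X → SteinerCut T W → W ⊆ X → Descends G W X
  extreme-descends (_ , minimal) cutW W⊆X with ⊆⇒≡⊎⊂ W⊆X
  ... | inj₁ W≡X = inj₁ (sym W≡X)
  ... | inj₂ W⊂X = inj₂ (minimal _ cutW W⊂X)

  ∪-extreme-descends : ∀ {X W} → NonNegativeWeights G → Extreme G T X → SteinerCut T W →
    Nonempty ((W ∩ X) ∩ T) → Descends G W (W ∪ X)
  ∪-extreme-descends {X} {W} nonneg extX cutW meet with extreme-descends extX cutW∩X (p∩q⊆q W X)
    where
    cutW∩X : SteinerCut T (W ∩ X)
    cutW∩X = meet , λ T⊆W∩X → proj₂ (proj₁ extX) (λ t∈T → p∩q⊆q W X (T⊆W∩X t∈T))
  ... | inj₁ X≡W∩X = inj₁ (trans (cong (W ∪_) X≡W∩X) (∪-abs-∩ W X))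
  ... | inj₂ dX<dW∩X = inj₂ (+-cancelʳ-< (d G X) (begin-strict
    d G (W ∪ X) + d G X       <⟨ +-monoʳ-< (d G (W ∪ X)) dX<dW∩X ⟩
    d G (W ∪ X) + d G (W ∩ X) ≡⟨ +-comm (d G (W ∪ X)) (d G (W ∩ X)) ⟩
    d G (W ∩ X) + d G (W ∪ X) ≤⟨ d-submodular G nonneg W X ⟩
    d G W + d G X             ∎))
    where open ≤-Reasoning

  ∪-extreme : ∀ {X Y} → NonNegativeWeights G → Extreme G T X → Extreme G T Y →
    X ∩ T ≡ Y ∩ T → Extreme G T (X ∪ Y) × (X ∪ Y) ∩ T ≡ X ∩ T
  ∪-extreme {X} {Y} nonneg extX extY X∩T≡Y∩T = (cutX∪Y , minimal) , trace
    where
    trace : (X ∪ Y) ∩ T ≡ X ∩ T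
    trace = begin
      (X ∪ Y) ∩ T         ≡⟨ ∩-distribʳ-∪ T X Y ⟩
      (X ∩ T) ∪ (Y ∩ T)   ≡⟨ cong ((X ∩ T) ∪_) (sym X∩T≡Y∩T) ⟩
      (X ∩ T) ∪ (X ∩ T)   ≡⟨ ∪-idem (X ∩ T) ⟩
      X ∩ T               ∎
      where open ≡-Reasoning

    T⊈X∪Y : ¬ T ⊆ X ∪ Y
    T⊈X∪Y T⊆X∪Y = proj₂ (proj₁ extX) (λ t∈T → ∩-trace-∈ trace (T⊆X∪Y t∈T) t∈T)

    cutX∪Y : SteinerCut T (X ∪ Y)
    cutX∪Y = subst Nonempty (sym trace) (proj₁ (proj₁ extX)) , T⊈X∪Y

    minimal : ∀ Z → SteinerCut T Z → Z ⊂ X ∪ Y → d G (X ∪ Y) < d G Z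
    minimal Z cutZ Z⊂X∪Y with Descends-trans {G = G} descendX descendY
      where
      Z⊆X∪Y : Z ⊆ X ∪ Y
      Z⊆X∪Y = proj₁ Z⊂X∪Y
      z : Fin n
      z = proj₁ (proj₁ cutZ)
      z∈Z : z ∈ Z
      z∈Z = proj₁ (x∈p∩q⁻ Z T (proj₂ (proj₁ cutZ)))
      z∈T : z ∈ T
      z∈T = proj₂ (x∈p∩q⁻ Z T (proj₂ (proj₁ cutZ)))
      z∈X : z ∈ X
      z∈X = ∩-trace-∈ trace (Z⊆X∪Y z∈Z) z∈T
      z∈Y : z ∈ Y
      z∈Y = ∩-trace-∈ X∩T≡Y∩T z∈X z∈T

      descendX : Descends G Z (Z ∪ X)
      descendX = ∪-extreme-descends nonneg extX cutZ (z , x∈p∩q⁺ (x∈p∩q⁺ (z∈Z , z∈X) , z∈T))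

      Z∪X⊆X∪Y : Z ∪ X ⊆ X ∪ Y
      Z∪X⊆X∪Y z∈Z∪X = [ Z⊆X∪Y , p⊆p∪q Y ] (x∈p∪q⁻ Z X z∈Z∪X)

      cutZ∪X : SteinerCut T (Z ∪ X)
      cutZ∪X = (z , x∈p∩q⁺ (p⊆p∪q X z∈Z , z∈T)) , λ T⊆Z∪X → T⊈X∪Y (λ t∈T → Z∪X⊆X∪Y (T⊆Z∪X t∈T))

      descendY : Descends G (Z ∪ X) (X ∪ Y)
      descendY = subst (Descends G (Z ∪ X)) (trans (∪-assoc Z X Y) (⊆⇒∪≡ Z⊆X∪Y))
        (∪-extreme-descends nonneg extY cutZ∪X (z , x∈p∩q⁺ (x∈p∩q⁺ (p⊆p∪q X z∈Z , z∈Y) , z∈T)))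
    ... | inj₁ X∪Y≡Z   = ⊥-elim (⊂-irref (sym X∪Y≡Z) Z⊂X∪Y)
    ... | inj₂ dX∪Y<dZ = dX∪Y<dZ

module _ {n} (P : Subset n → Set) (∪-closed : ∀ {X Y} → P X → P Y → P (X ∪ Y)) where

  ∪-closed-covering : ∀ {X₀} M → P X₀ → (∀ {X} → P X → X ⊆ M) →
    (∀ {x} → x ∈ M → ∃ λ X → P X × x ∈ X) → P M
  ∪-closed-covering {X₀} M P-X₀ P⊆M M⊆⋃P with cover (allFin n)
    where
    cover : (xs : List (Fin n)) → ∃ λ X → P X × (∀ {x} → x List.∈ xs → x ∈ M → x ∈ X)
    cover []       = X₀ , P-X₀ , λ ()
    cover (x ∷ xs) with cover xs | x ∈? M
    ... | X , P-X , covers | no x∉M = X , P-X , λ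
      { (here refl) x∈M → contradiction x∈M x∉M
      ; (there y∈xs) → covers y∈xs }
    ... | X , P-X , covers | yes x∈M with M⊆⋃P x∈M
    ...   | Y , P-Y , x∈Y = X ∪ Y , ∪-closed P-X P-Y , λ
      { (here refl) _ → q⊆p∪q X Y x∈Y
      ; (there y∈xs) y∈M → p⊆p∪q Y (covers y∈xs y∈M) }
  ... | X , P-X , covers = subst P (⊆-antisym (P⊆M P-X) (covers (∈-allFin _))) P-X

mainTheorem5 : ∀ (n : ℕ) (G : Graph n) → PositiveWeights G →
    ∀ (T R : Subset n) → R ⊆ T → SupremeDefined G T R →
    ∀ (M : Subset n) → IsSupremeSet G T R M →
    Extreme G T M × (M ∩ T ≡ R)
mainTheorem5 n G pos T R _ (X₀ , good₀) M supreme =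
  ∪-closed-covering Good ∪-good M good₀ good⊆M M⊆⋃good
  where
  Good : Subset n → Set
  Good X = Extreme G T X × X ∩ T ≡ R

  ∪-good : ∀ {X Y} → Good X → Good Y → Good (X ∪ Y)
  ∪-good (extX , X∩T≡R) (extY , Y∩T≡R) =
    let extX∪Y , trace = ∪-extreme (All.map <⇒≤ pos) extX extY (trans X∩T≡R (sym Y∩T≡R))
    in extX∪Y , trans trace X∩T≡R

  good⊆M : ∀ {X} → Good X → X ⊆ M
  good⊆M (extX , X∩T≡R) x∈X = Equivalence.from (supreme _) (_ , extX , X∩T≡R , x∈X)

  M⊆⋃good : ∀ {x} → x ∈ M → ∃ λ X → Good X × x ∈ X
  M⊆⋃good x∈M =
    let X , extX , X∩T≡R , x∈X = Equivalence.to (supreme _) x∈M in X , (extX , X∩T≡R) , x∈X
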